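{- For every integer $n>1$ the complete graph $K_n$ admits no extended irregular dominating set, and for all positive integers $m,n$ the complete bipartite graph $K_{m,n}$ admits no extended irregular dominating set.
   Context: Let $\Gamma=(V,E)$ be an undirected simple graph with graph distance $d$. A vertex $v$ carrying a positive integer label $\ell$ dominates exactly the vertices $u$ with $d(u,v)=\ell$; a vertex carrying label $0$ dominates only itself. An extended irregular dominating set is a set $S\subseteq V$ together with an injective labeling $\lambda:S\to\{0,1,2,\dots\}$ such that every vertex of $V$ is dominated by at least one vertex of $S$, where some vertex of $S$ has label $0$. -}

module Defs where

open import Level using (0ℓ)
open import Data.Nat using (ℕ; zero; suc; _<_)
open import Data.Fin using (Fin)
open import Data.Sum using (_⊎_; inj₁; inj₂)
open import Data.Product using (Σ; ∃; _×_; _,_)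
open import Data.Maybe using (Maybe; just; nothing)
open import Data.Empty using (⊥)
open import Data.Unit using (⊤)
open import Relation.Nullary using (¬_)
open import Relation.Binary.PropositionalEquality using (_≡_)

record Graph : Set₁ where
  field
    V    : Set
    Adj  : V → V → Set
    sym  : ∀ {u v} → Adj u v → Adj v u
    irr  : ∀ {v} → ¬ Adj v v
open Graph public

data Walk (Γ : Graph) : V Γ → V Γ → ℕ → Set where
  here : ∀ {v} → Walk Γ v v zero
  step : ∀ {u w v k} → Adj Γ u w → Walk Γ w v k → Walk Γ u v (suc k)

Dist : (Γ : Graph) → V Γ → V Γ → ℕ → Set
Dist Γ u v k = Walk Γ u v k × (∀ j → j < k → ¬ Walk Γ u v j)

Dominates : (Γ : Graph) → V Γ → ℕ → V Γ → Set
Dominates Γ v zero    u = u ≡ v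
Dominates Γ v (suc ℓ) u = Dist Γ u v (suc ℓ)

-- An extended irregular dominating set: a set S ⊆ V with an injective labeling
-- λ : S → ℕ, encoded as a partial labeling lab : V → Maybe ℕ
-- (S = {v | lab v ≡ just _}), such that every vertex is dominated by some
-- vertex of S and some vertex of S has label 0.
record ExtIrrDomSet (Γ : Graph) : Set where
  field
    lab       : V Γ → Maybe ℕ
    injective : ∀ {u v k} → lab u ≡ just k → lab v ≡ just k → u ≡ v
    dominated : ∀ u → Σ (V Γ) λ v → Σ ℕ λ ℓ → (lab v ≡ just ℓ) × Dominates Γ v ℓ u
    hasZero   : Σ (V Γ) λ v → lab v ≡ just zero

complete : ℕ → Graph
complete n = record
  { V = Fin n
  ; Adj = λ u v → ¬ (u ≡ v)
  ; sym = λ p q → p (Relation.Binary.PropositionalEquality.sym q)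
  ; irr = λ p → p Relation.Binary.PropositionalEquality.refl
  }

bipAdj : ∀ {m n} → Fin m ⊎ Fin n → Fin m ⊎ Fin n → Set
bipAdj (inj₁ _) (inj₁ _) = ⊥
bipAdj (inj₁ _) (inj₂ _) = ⊤
bipAdj (inj₂ _) (inj₁ _) = ⊤
bipAdj (inj₂ _) (inj₂ _) = ⊥

bipSym : ∀ {m n} {u v : Fin m ⊎ Fin n} → bipAdj u v → bipAdj v u
bipSym {u = inj₁ _} {inj₂ _} t = t
bipSym {u = inj₂ _} {inj₁ _} t = t

bipIrr : ∀ {m n} {v : Fin m ⊎ Fin n} → ¬ bipAdj v v
bipIrr {v = inj₁ _} ()
bipIrr {v = inj₂ _} ()

completeBipartite : ℕ → ℕ → Graph
completeBipartite m n = record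
  { V = Fin m ⊎ Fin n
  ; Adj = bipAdj
  ; sym = bipSym
  ; irr = bipIrr
  }

module Submission where

-- In a graph of diameter at most 2 only the labels 0, 1 and 2 dominate anything.
-- A vertex with a positive label is dominated neither by itself nor by the label-0
-- vertex, so it is dominated by the other one of the labels 1 and 2; hence the
-- vertices a, b labelled 1 and 2 would satisfy d(a,b) = 2 and d(b,a) = 1 at once.
-- So no vertex carries a positive label, and a second vertex besides the one
-- labelled 0 is left undominated. K_n (n > 1) and K_{m,n} have diameter at most 2.

open import Defs
open import Data.Nat using (ℕ; zero; suc; _<_; _≤_; z≤n; s≤s; s≤s⁻¹)
open import Data.Nat.Properties using (<-cmp; ≮⇒≥; ≤-refl; ≤-trans)
open import Data.Fin using (Fin; fromℕ<) renaming (zero to fzero; suc to fsuc)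
open import Data.Fin.Properties using (_≟_)
open import Data.Maybe using (just)
open import Data.Maybe.Properties using (just-injective)
open import Data.Product using (_×_; Σ; ∃; _,_; proj₁; proj₂)
open import Data.Sum using (inj₁; inj₂)
open import Data.Unit using (tt)
open import Data.Empty using (⊥-elim)
open import Relation.Binary using (tri<; tri≈; tri>)
open import Relation.Nullary using (¬_; yes; no)
open import Relation.Binary.PropositionalEquality using (_≡_; _≢_; refl; trans) renaming (sym to ≡-sym)

module _ {Γ : Graph} where

  Walk-snoc : ∀ {u w v k} → Walk Γ u w k → Adj Γ w v → Walk Γ u v (suc k)
  Walk-snoc here       e = step e here
  Walk-snoc (step f p) e = step f (Walk-snoc p e)

  Walk-reverse : ∀ {u v k} → Walk Γ u v k → Walk Γ v u k
  Walk-reverse here       = here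
  Walk-reverse (step e p) = Walk-snoc (Walk-reverse p) (Graph.sym Γ e)

  Dist-refl : ∀ {u} → Dist Γ u u 0
  Dist-refl = here , λ _ ()

  Dist-sym : ∀ {u v k} → Dist Γ u v k → Dist Γ v u k
  Dist-sym (p , shortest) = Walk-reverse p , λ j j<k q → shortest j j<k (Walk-reverse q)

  Dist-≤-Walk : ∀ {u v j k} → Walk Γ u v j → Dist Γ u v k → k ≤ j
  Dist-≤-Walk p (_ , shortest) = ≮⇒≥ λ j<k → shortest _ j<k p

  Dist-unique : ∀ {u v j k} → Dist Γ u v j → Dist Γ u v k → j ≡ k
  Dist-unique {j = j} {k} (p , shortest₁) (q , shortest₂) with <-cmp j k
  ... | tri< j<k _ _ = ⊥-elim (shortest₂ j j<k p)
  ... | tri≈ _ j≡k _ = j≡k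
  ... | tri> _ _ k<j = ⊥-elim (shortest₁ k k<j q)

DiameterAtMost : Graph → ℕ → Set
DiameterAtMost Γ d = ∀ u v → ∃ λ j → j ≤ d × Walk Γ u v j

Dist-≤-diameter : ∀ {Γ d u v k} → DiameterAtMost Γ d → Dist Γ u v k → k ≤ d
Dist-≤-diameter {u = u} {v} diam dist with diam u v
... | j , j≤d , p = ≤-trans (Dist-≤-Walk p dist) j≤d

-- Constructively stronger than merely having two distinct vertices.
EveryVertexHasAnother : Graph → Set
EveryVertexHasAnother Γ = ∀ z → Σ (V Γ) λ u → u ≢ z

module _ {Γ : Graph} (diam : DiameterAtMost Γ 2) (D : ExtIrrDomSet Γ) where
  open ExtIrrDomSet D

  PositiveDominator : V Γ → ℕ → Set
  PositiveDominator u k = Σ (V Γ) λ v → Σ ℕ λ ℓ →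
    lab v ≡ just (suc ℓ) × Dist Γ u v (suc ℓ) × ℓ ≢ k × ℓ ≤ 1

  positiveDominator : ∀ {u k} → lab u ≡ just (suc k) → PositiveDominator u k
  positiveDominator {u} {k} lu with dominated u
  ... | _ , zero , lv , refl with () ← just-injective (trans (≡-sym lu) lv)
  ... | v , suc ℓ , lv , d = v , ℓ , lv , d , ℓ≢k , s≤s⁻¹ (Dist-≤-diameter diam d)
    where
    ℓ≢k : ℓ ≢ k
    ℓ≢k refl with refl ← injective lu lv with () ← Dist-unique d Dist-refl

  dominatorOfLabel1 : ∀ {a} → lab a ≡ just 1 → ∃ λ b → lab b ≡ just 2 × Dist Γ a b 2
  dominatorOfLabel1 la with positiveDominator la
  ... | _ , zero , _ , _ , 0≢0 , _ = ⊥-elim (0≢0 refl)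
  ... | b , suc zero , lb , d , _ = b , lb , d
  ... | _ , suc (suc _) , _ , _ , _ , s≤s ()

  dominatorOfLabel2 : ∀ {b} → lab b ≡ just 2 → ∃ λ a → lab a ≡ just 1 × Dist Γ b a 1
  dominatorOfLabel2 lb with positiveDominator lb
  ... | a , zero , la , d , _ = a , la , d
  ... | _ , suc zero , _ , _ , 1≢1 , _ = ⊥-elim (1≢1 refl)
  ... | _ , suc (suc _) , _ , _ , _ , s≤s ()

  noLabel1 : ∀ {a} → lab a ≢ just 1
  noLabel1 la with dominatorOfLabel1 la
  ... | b , lb , dab with dominatorOfLabel2 lb
  ... | a′ , la′ , dba with refl ← injective la la′ with () ← Dist-unique (Dist-sym dab) dba

  noPositiveLabel : ∀ {v k} → lab v ≢ just (suc k)
  noPositiveLabel lv with positiveDominator lv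
  ... | _ , zero , lu , _ = noLabel1 lu
  ... | _ , suc zero , lu , _ = noLabel1 (proj₁ (proj₂ (dominatorOfLabel2 lu)))
  ... | _ , suc (suc _) , _ , _ , _ , s≤s ()

  everyVertexLabelledZero : ∀ u → lab u ≡ just 0
  everyVertexLabelledZero u with dominated u
  ... | _ , zero , lu , refl = lu
  ... | _ , suc _ , lv , _ = ⊥-elim (noPositiveLabel lv)

noExtIrrDomSet : ∀ {Γ} → DiameterAtMost Γ 2 → EveryVertexHasAnother Γ → ¬ ExtIrrDomSet Γ
noExtIrrDomSet diam another D =
  let z , lz = hasZero
      u , u≢z = another z
  in u≢z (injective (everyVertexLabelledZero diam D u) lz)
  where open ExtIrrDomSet D

complete-diameter≤2 : ∀ n → DiameterAtMost (complete n) 2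
complete-diameter≤2 n u v with u ≟ v
... | yes refl = 0 , z≤n , here
... | no u≢v   = 1 , s≤s z≤n , step u≢v here

complete-everyVertexHasAnother : ∀ {n} → 1 < n → EveryVertexHasAnother (complete n)
complete-everyVertexHasAnother {suc (suc _)} _ fzero    = fsuc fzero , λ ()
complete-everyVertexHasAnother {suc (suc _)} _ (fsuc _) = fzero , λ ()
complete-everyVertexHasAnother {suc zero} (s≤s ()) _

module _ {m n} (x : Fin m) (y : Fin n) where

  completeBipartite-diameter≤2 : DiameterAtMost (completeBipartite m n) 2
  completeBipartite-diameter≤2 (inj₁ i) (inj₂ j) = 1 , s≤s z≤n , step tt here
  completeBipartite-diameter≤2 (inj₂ i) (inj₁ j) = 1 , s≤s z≤n , step tt here
  completeBipartite-diameter≤2 (inj₁ i) (inj₁ j) with i ≟ j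
  ... | yes refl = 0 , z≤n , here
  ... | no _     = 2 , ≤-refl , step {w = inj₂ y} tt (step tt here)
  completeBipartite-diameter≤2 (inj₂ i) (inj₂ j) with i ≟ j
  ... | yes refl = 0 , z≤n , here
  ... | no _     = 2 , ≤-refl , step {w = inj₁ x} tt (step tt here)

  completeBipartite-everyVertexHasAnother : EveryVertexHasAnother (completeBipartite m n)
  completeBipartite-everyVertexHasAnother (inj₁ _) = inj₂ y , λ ()
  completeBipartite-everyVertexHasAnother (inj₂ _) = inj₁ x , λ ()

corollary2p3 : ((n : ℕ) → 1 < n → ¬ ExtIrrDomSet (complete n))
    × ((m n : ℕ) → 0 < m → 0 < n → ¬ ExtIrrDomSet (completeBipartite m n))
corollary2p3 = noExtIrrDomSet-complete , noExtIrrDomSet-completeBipartite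
  where
  noExtIrrDomSet-complete : (n : ℕ) → 1 < n → ¬ ExtIrrDomSet (complete n)
  noExtIrrDomSet-complete n 1<n =
    noExtIrrDomSet (complete-diameter≤2 n) (complete-everyVertexHasAnother 1<n)

  noExtIrrDomSet-completeBipartite : (m n : ℕ) → 0 < m → 0 < n → ¬ ExtIrrDomSet (completeBipartite m n)
  noExtIrrDomSet-completeBipartite m n 0<m 0<n =
    let x = fromℕ< 0<m
        y = fromℕ< 0<n
    in noExtIrrDomSet (completeBipartite-diameter≤2 x y) (completeBipartite-everyVertexHasAnother x y)
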